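{- Let $p,q\ge3$ be integers with $(p-2)(q-2)>4$, and let $W=\lim_{k\to\infty}W_k$ be the limit word of the nested sequence of words $W_k$ defined below. Then for every $i\ge1$, the $i$-th letter of $W$ equals \[ q-\lfloor i\beta\rfloor+\lfloor (i-1)\beta\rfloor. \]
   Context: $\beta=\frac{(p-2)(q-2)+\sqrt{(p-2)^2(q-2)^2-4(p-2)(q-2)}}{2(p-2)}$. Words over the digits are concatenations; $x^a$ denotes $a$ consecutive copies of $x$ (empty if $a=0$). The words $U_k,W_k$ ($k\ge1$) are defined recursively as follows. If $p=3$ (so $q\ge7$): $U_1=3$, $W_1=4$, $U_{k+1}=W_kU_k^{q-5}$, $W_{k+1}=W_kU_k^{q-6}$. If $p\ge4$ and $q\ge4$: $U_1=2$, $W_1=3$, $U_{k+1}=W_kU_k^{p-4}(W_kU_k^{p-3})^{q-3}$, $W_{k+1}=W_kU_k^{p-4}(W_kU_k^{p-3})^{q-4}$. If $q=3$ (so $p\ge7$): $U_1=2$, $W_1=32$, $U_{k+1}=W_kU_k^{p-5}$, $W_{k+1}=W_kU_k^{p-6}$. Each $W_k$ is a prefix of $W_{k+1}$, and $W$ denotes the resulting infinite limit word. (These words encode the degrees of perimeter vertices of layered extremal animals in the $\{p,q\}$-tessellation.) -}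

module Defs where

open import Data.Nat using (ℕ; zero; suc; _+_; _*_; _∸_; _^_; _≤_; _<_)
open import Data.List using (List; []; _∷_; _++_; concat; replicate)
open import Data.Product using (_×_; _,_; proj₁; proj₂)
open import Data.Sum using (_⊎_)

rep : List ℕ → ℕ → List ℕ
rep x a = concat (replicate a x)

-- words p q k = (U_{k+1} , W_{k+1})   (k ≥ 0, i.e. indices start at 1)
-- Case p = 3 (q ≥ 7); case q = 3 (p ≥ 7); otherwise p,q ≥ 4.
words : ℕ → ℕ → ℕ → List ℕ × List ℕ
words 3 q zero = (3 ∷ [] , 4 ∷ [])
words 3 q (suc k) =
  let U = proj₁ (words 3 q k) ; W = proj₂ (words 3 q k)
  in (W ++ rep U (q ∸ 5) , W ++ rep U (q ∸ 6))
words p 3 zero = (2 ∷ [] , 3 ∷ 2 ∷ [])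
words p 3 (suc k) =
  let U = proj₁ (words p 3 k) ; W = proj₂ (words p 3 k)
  in (W ++ rep U (p ∸ 5) , W ++ rep U (p ∸ 6))
words p q zero = (2 ∷ [] , 3 ∷ [])
words p q (suc k) =
  let U = proj₁ (words p q k) ; W = proj₂ (words p q k)
  in ( W ++ rep U (p ∸ 4) ++ rep (W ++ rep U (p ∸ 3)) (q ∸ 3)
     , W ++ rep U (p ∸ 4) ++ rep (W ++ rep U (p ∸ 3)) (q ∸ 4) )

Wword : ℕ → ℕ → ℕ → List ℕ
Wword p q k = proj₂ (words p q k)

-- β = (m + √D) / (2r) with m = (p-2)(q-2), r = p-2, D = m² - 4m.
mB : ℕ → ℕ → ℕ
mB p q = (p ∸ 2) * (q ∸ 2)

rB : ℕ → ℕ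
rB p = p ∸ 2

DB : ℕ → ℕ → ℕ
DB p q = mB p q * mB p q ∸ 4 * mB p q

-- n ≤ i·β  ⟺  2rn − im ≤ i√D  ⟺  2rn ≤ im  or  (2rn − im)² ≤ i²D
LeIBeta : ℕ → ℕ → ℕ → ℕ → Set
LeIBeta p q i n =
  (2 * rB p * n ≤ i * mB p q) ⊎
  ((2 * rB p * n ∸ i * mB p q) ^ 2 ≤ i ^ 2 * DB p q)

-- i·β < n  ⟺  i√D < 2rn − im  ⟺  im < 2rn  and  i²D < (2rn − im)²
LtIBeta : ℕ → ℕ → ℕ → ℕ → Set
LtIBeta p q i n =
  (i * mB p q < 2 * rB p * n) ×
  (i ^ 2 * DB p q < (2 * rB p * n ∸ i * mB p q) ^ 2)

-- n = ⌊ i·β ⌋  (exact encoding of  n ≤ iβ < n+1  in integer arithmetic)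
IsFloorIBeta : ℕ → ℕ → ℕ → ℕ → Set
IsFloorIBeta p q i n = LeIBeta p q i n × LtIBeta p q i (suc n)

module Submission where

-- Write R = p − 2 and S = q − 2, so that β = β(p,q) is the larger root of R x² − R S x + S, and
-- γ = β(q,p) the larger root of S x² − R S x + R. Then β = S − 1/γ, hence ⌊iβ⌋ = S i − ⌈i/γ⌉:
-- for i running from ⌊nγ⌋ + 1 to ⌊(n+1)γ⌋ the floor of iβ grows first by S − 1 and then by S.
-- In terms of the letters q − ⌊(i+1)β⌋ + ⌊iβ⌋ this says that the word of β is the image of the
-- word of γ under x ↦ 3 2^(p−1−x), and as W_{k+1} = σ_p(σ_q(W_k)) for these substitutions the
-- claim follows by induction on k. For p = 3 the same argument applies to δ = β − 1, whose floor
-- increments are those of β lowered by one and which satisfies β = (q − 3) − 1/δ; this gives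
-- W_{k+1} = ψ(W_k) with ψ(x) = 4 3^(q−2−x). For q = 3 one σ_p-step leads back to the case p = 3.
-- Every comparison with β is made through the quadratic polynomial it annihilates.

module Roots where

  open import Data.Nat
  open import Data.Nat.Properties
  open import Data.Nat.Tactic.RingSolver using (solve-∀)
  open import Data.Product using (_×_; _,_)
  open import Data.Sum using (_⊎_; inj₁; inj₂)
  open import Relation.Binary.PropositionalEquality
  open import Relation.Nullary using (yes; no)
  open import Defs

  ≤-reshape : ∀ {x y k a b e} → x + k ≡ a + e → y + k ≡ b + e → x ≤ y → a ≤ b
  ≤-reshape {k = k} {a} {b} {e} x+k≡a+e y+k≡b+e x≤y =
    +-cancelʳ-≤ e a b (subst₂ _≤_ x+k≡a+e y+k≡b+e (+-monoˡ-≤ k x≤y))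

  <-reshape : ∀ {x y k a b e} → x + k ≡ a + e → y + k ≡ b + e → x < y → a < b
  <-reshape {k = k} {a} {b} {e} x+k≡a+e y+k≡b+e x<y =
    +-cancelʳ-< e a b (subst₂ _<_ x+k≡a+e y+k≡b+e (+-monoˡ-< k x<y))

  -- β, the larger root of R x² − R S x + S, lies right of the vertex S/2: LeIRoot R S i n says
  -- n ≤ iβ and LtIRoot R S i n says iβ < n.
  LeIRoot : ℕ → ℕ → ℕ → ℕ → Set
  LeIRoot R S i n = (2 * n ≤ S * i) ⊎ (S * (i * i) + R * (n * n) ≤ R * S * i * n)

  LtIRoot : ℕ → ℕ → ℕ → ℕ → Set
  LtIRoot R S i n = (S * i < 2 * n) × (R * S * i * n < S * (i * i) + R * (n * n))

  -- For c = 2Rn − iRS and D = (RS)² − 4RS, excess-square and discriminant together say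
  -- c² − i²D = 4R (S i² + R n² − R S i n), with all negative terms moved to the other side.
  private
    cross : ℕ → ℕ → ℕ → ℕ → ℕ
    cross R S i n = 2 * (2 * R * n) * (i * (R * S)) + 4 * (i * i) * (R * S)

    offset : ℕ → ℕ → ℕ → ℕ
    offset R S i = (i * i) * ((R * S) * (R * S))

    square : ∀ x → x ^ 2 ≡ x * x
    square x = cong (x *_) (*-identityʳ x)

    square-of-difference : ∀ a b c x → a ≡ b + c → c * c + (2 * a * b + x) ≡ a * a + b * b + x
    square-of-difference .(b + c) b c x refl = identity b c x
      where
      identity : ∀ b c x → c * c + (2 * (b + c) * b + x) ≡ (b + c) * (b + c) + b * b + x
      identity = solve-∀

    excess-square : ∀ R S i n c → 2 * R * n ≡ i * (R * S) + c →
      c ^ 2 + cross R S i n ≡ 4 * R * (S * (i * i) + R * (n * n)) + offset R S i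
    excess-square R S i n c eq = begin
      c ^ 2 + cross R S i n
        ≡⟨ cong (_+ cross R S i n) (square c) ⟩
      c * c + (2 * (2 * R * n) * (i * (R * S)) + 4 * (i * i) * (R * S))
        ≡⟨ square-of-difference (2 * R * n) (i * (R * S)) c (4 * (i * i) * (R * S)) eq ⟩
      (2 * R * n) * (2 * R * n) + (i * (R * S)) * (i * (R * S)) + 4 * (i * i) * (R * S)
        ≡⟨ expand R S i n ⟩
      4 * R * (S * (i * i) + R * (n * n)) + offset R S i ∎
      where
      open ≡-Reasoning
      expand : ∀ R S i n → (2 * R * n) * (2 * R * n) + (i * (R * S)) * (i * (R * S)) + 4 * (i * i) * (R * S)
                         ≡ 4 * R * (S * (i * i) + R * (n * n)) + (i * i) * ((R * S) * (R * S))
      expand = solve-∀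

    discriminant : ∀ R S i n → 4 ≤ R * S →
      i ^ 2 * ((R * S) * (R * S) ∸ 4 * (R * S)) + cross R S i n ≡ 4 * R * (R * S * i * n) + offset R S i
    discriminant R S i n 4≤RS = begin
      i ^ 2 * (RS² ∸ 4 * (R * S)) + cross R S i n
        ≡⟨ cong (λ m → m * (RS² ∸ 4 * (R * S)) + cross R S i n) (square i) ⟩
      (i * i) * (RS² ∸ 4 * (R * S)) + cross R S i n
        ≡⟨ regroup R S i n (RS² ∸ 4 * (R * S)) ⟩
      (i * i) * (RS² ∸ 4 * (R * S) + 4 * (R * S)) + 2 * (2 * R * n) * (i * (R * S))
        ≡⟨ cong (λ m → (i * i) * m + 2 * (2 * R * n) * (i * (R * S))) (m∸n+n≡m (*-monoˡ-≤ (R * S) 4≤RS)) ⟩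
      (i * i) * RS² + 2 * (2 * R * n) * (i * (R * S))
        ≡⟨ expand R S i n ⟩
      4 * R * (R * S * i * n) + offset R S i ∎
      where
      open ≡-Reasoning
      RS² = (R * S) * (R * S)
      regroup : ∀ R S i n d → (i * i) * d + (2 * (2 * R * n) * (i * (R * S)) + 4 * (i * i) * (R * S))
                            ≡ (i * i) * (d + 4 * (R * S)) + 2 * (2 * R * n) * (i * (R * S))
      regroup = solve-∀
      expand : ∀ R S i n → (i * i) * ((R * S) * (R * S)) + 2 * (2 * R * n) * (i * (R * S))
                         ≡ 4 * R * (R * S * i * n) + (i * i) * ((R * S) * (R * S))
      expand = solve-∀

    2Rn≡R[2n] : ∀ R n → 2 * R * n ≡ R * (2 * n)
    2Rn≡R[2n] = solve-∀

    i[RS]≡R[Si] : ∀ R S i → i * (R * S) ≡ R * (S * i)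
    i[RS]≡R[Si] = solve-∀

  module RootConversion (R S : ℕ) .{{_ : NonZero R}} (4≤RS : 4 ≤ R * S) where

    private
      instance
        4R≢0 : NonZero (4 * R)
        4R≢0 = m*n≢0 4 R

      square-form : ∀ i n → i * (R * S) < 2 * R * n →
        (2 * R * n ∸ i * (R * S)) ^ 2 + cross R S i n ≡ 4 * R * (S * (i * i) + R * (n * n)) + offset R S i
      square-form i n lt = excess-square R S i n _ (sym (m+[n∸m]≡n (<⇒≤ lt)))

      cancel-R-≤ : ∀ {i n} → 2 * R * n ≤ i * (R * S) → 2 * n ≤ S * i
      cancel-R-≤ {i} {n} le = *-cancelˡ-≤ R (subst₂ _≤_ (2Rn≡R[2n] R n) (i[RS]≡R[Si] R S i) le)

      scale-R-≤ : ∀ {i n} → 2 * n ≤ S * i → 2 * R * n ≤ i * (R * S)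
      scale-R-≤ {i} {n} le = subst₂ _≤_ (sym (2Rn≡R[2n] R n)) (sym (i[RS]≡R[Si] R S i)) (*-monoʳ-≤ R le)

      cancel-R-< : ∀ {i n} → i * (R * S) < 2 * R * n → S * i < 2 * n
      cancel-R-< {i} {n} lt = *-cancelˡ-< R _ _ (subst₂ _<_ (i[RS]≡R[Si] R S i) (2Rn≡R[2n] R n) lt)

      scale-R-< : ∀ {i n} → S * i < 2 * n → i * (R * S) < 2 * R * n
      scale-R-< {i} {n} lt = subst₂ _<_ (sym (i[RS]≡R[Si] R S i)) (sym (2Rn≡R[2n] R n)) (*-monoʳ-< R lt)

    LeIBeta⇒LeIRoot : ∀ {i n} → LeIBeta (2 + R) (2 + S) i n → LeIRoot R S i n
    LeIBeta⇒LeIRoot (inj₁ le) = inj₁ (cancel-R-≤ le)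
    LeIBeta⇒LeIRoot {i} {n} (inj₂ le) with 2 * R * n ≤? i * (R * S)
    ... | yes le′ = inj₁ (cancel-R-≤ le′)
    ... | no le′ = inj₂ (*-cancelˡ-≤ (4 * R)
            (≤-reshape (square-form i n (≰⇒> le′)) (discriminant R S i n 4≤RS) le))

    LeIRoot⇒LeIBeta : ∀ {i n} → LeIRoot R S i n → LeIBeta (2 + R) (2 + S) i n
    LeIRoot⇒LeIBeta (inj₁ le) = inj₁ (scale-R-≤ le)
    LeIRoot⇒LeIBeta {i} {n} (inj₂ le) with 2 * R * n ≤? i * (R * S)
    ... | yes le′ = inj₁ le′
    ... | no le′ = inj₂ (≤-reshape (sym (square-form i n (≰⇒> le′)))
            (sym (discriminant R S i n 4≤RS)) (*-monoʳ-≤ (4 * R) le))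

    LtIBeta⇒LtIRoot : ∀ {i n} → LtIBeta (2 + R) (2 + S) i n → LtIRoot R S i n
    LtIBeta⇒LtIRoot {i} {n} (lt , lt′) = cancel-R-< lt , *-cancelˡ-< (4 * R) _ _
      (<-reshape (discriminant R S i n 4≤RS) (square-form i n lt) lt′)

    LtIRoot⇒LtIBeta : ∀ {i n} → LtIRoot R S i n → LtIBeta (2 + R) (2 + S) i n
    LtIRoot⇒LtIBeta {i} {n} (lt , lt′) = scale-R-< lt , <-reshape (sym (discriminant R S i n 4≤RS))
      (sym (square-form i n (scale-R-< lt))) (*-monoʳ-< (4 * R) lt′)

  LtIBeta-mono : ∀ {p q n i j} → i ≤ j → LtIBeta p q n i → LtIBeta p q n j
  LtIBeta-mono {p} {q} {n} i≤j (linear , quadratic) =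
    <-≤-trans linear (*-monoʳ-≤ (2 * rB p) i≤j) ,
    <-≤-trans quadratic (^-monoˡ-≤ 2 (∸-monoˡ-≤ (n * mB p q) (*-monoʳ-≤ (2 * rB p) i≤j)))

  LeIBeta-antimono : ∀ {p q n i j} → i ≤ j → LeIBeta p q n j → LeIBeta p q n i
  LeIBeta-antimono {p} i≤j (inj₁ linear) = inj₁ (≤-trans (*-monoʳ-≤ (2 * rB p) i≤j) linear)
  LeIBeta-antimono {p} {q} {n} i≤j (inj₂ quadratic) =
    inj₂ (≤-trans (^-monoˡ-≤ 2 (∸-monoˡ-≤ (n * mB p q) (*-monoʳ-≤ (2 * rB p) i≤j))) quadratic)

  floor-zero : ∀ R S .{{_ : NonZero R}} → 4 ≤ R * S → IsFloorIBeta (2 + R) (2 + S) 0 0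
  floor-zero R S 4≤RS = LeIRoot⇒LeIBeta {0} {0} (inj₁ z≤n) , LtIRoot⇒LtIBeta {0} {1} (linear , quadratic)
    where
    open RootConversion R S 4≤RS
    linear : S * 0 < 2 * 1
    linear = subst (_< 2) (sym (*-zeroʳ S)) (s≤s z≤n)
    quadratic : R * S * 0 * 1 < S * (0 * 0) + R * (1 * 1)
    quadratic = subst₂ _<_ (sym (vanishes R S)) (sym (collapses R S)) (>-nonZero⁻¹ R)
      where
      vanishes : ∀ R S → R * S * 0 * 1 ≡ 0
      vanishes = solve-∀
      collapses : ∀ R S → S * (0 * 0) + R * (1 * 1) ≡ R
      collapses = solve-∀

module Complements where

  open import Data.Nat
  open import Data.Nat.Properties
  open import Data.Nat.Tactic.RingSolver using (solve-∀)
  open import Data.Product using (_×_; _,_)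
  open import Data.Sum using (inj₁; inj₂)
  open import Relation.Binary.PropositionalEquality
  open import Relation.Nullary using (yes; no; contradiction)
  open Roots

  -- Given S i = h + u, the quadratic condition for (i, h) and the dual one for (u, i) both
  -- reduce to S i² ≤ R h u (and the strict ones to its negation).
  module Reduction (R S i h u : ℕ) (Si≡h+u : S * i ≡ h + u) where

    open ≤-Reasoning

    private
      product-split : R * S * i * h ≡ R * (h * h) + R * h * u
      product-split = trans (reorder R S i h) (trans (cong (R * h *_) Si≡h+u) (distrib R h u))
        where
        reorder : ∀ R S i h → R * S * i * h ≡ R * h * (S * i)
        reorder = solve-∀
        distrib : ∀ R h u → R * h * (h + u) ≡ R * (h * h) + R * h * u
        distrib = solve-∀

      dual-split : S * R * u * i ≡ R * h * u + R * (u * u)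
      dual-split = trans (reorder R S i u) (trans (cong (R * u *_) Si≡h+u) (distrib R h u))
        where
        reorder : ∀ R S i u → S * R * u * i ≡ R * u * (S * i)
        reorder = solve-∀
        distrib : ∀ R h u → R * u * (h + u) ≡ R * h * u + R * (u * u)
        distrib = solve-∀

    below-root⇐key : S * (i * i) ≤ R * h * u → S * (i * i) + R * (h * h) ≤ R * S * i * h
    below-root⇐key key = begin
      S * (i * i) + R * (h * h) ≤⟨ +-monoˡ-≤ (R * (h * h)) key ⟩
      R * h * u + R * (h * h)   ≡⟨ +-comm (R * h * u) (R * (h * h)) ⟩
      R * (h * h) + R * h * u   ≡⟨ product-split ⟨
      R * S * i * h             ∎

    key⇐dual-below-root : R * (u * u) + S * (i * i) ≤ S * R * u * i → S * (i * i) ≤ R * h * u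
    key⇐dual-below-root dual = +-cancelʳ-≤ (R * (u * u)) _ _ (begin
      S * (i * i) + R * (u * u) ≡⟨ +-comm (S * (i * i)) (R * (u * u)) ⟩
      R * (u * u) + S * (i * i) ≤⟨ dual ⟩
      S * R * u * i             ≡⟨ dual-split ⟩
      R * h * u + R * (u * u)   ∎)

    above-root⇐key : R * h * u < S * (i * i) → R * S * i * h < S * (i * i) + R * (h * h)
    above-root⇐key key = begin-strict
      R * S * i * h             ≡⟨ product-split ⟩
      R * (h * h) + R * h * u   <⟨ +-monoʳ-< (R * (h * h)) key ⟩
      R * (h * h) + S * (i * i) ≡⟨ +-comm (R * (h * h)) (S * (i * i)) ⟩
      S * (i * i) + R * (h * h) ∎

    key⇐dual-above-root : S * R * u * i < R * (u * u) + S * (i * i) → R * h * u < S * (i * i)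
    key⇐dual-above-root dual = +-cancelʳ-< (R * (u * u)) _ _ (begin-strict
      R * h * u + R * (u * u)   ≡⟨ dual-split ⟨
      S * R * u * i             <⟨ dual ⟩
      R * (u * u) + S * (i * i) ≡⟨ +-comm (R * (u * u)) (S * (i * i)) ⟩
      S * (i * i) + R * (u * u) ∎)

    below-root⇐linear : 2 * i ≤ R * u → LeIRoot R S i h
    below-root⇐linear 2i≤Ru with h ≤? u
    ... | yes h≤u = inj₁ (begin
      2 * h  ≡⟨ double h ⟩
      h + h  ≤⟨ +-monoʳ-≤ h h≤u ⟩
      h + u  ≡⟨ Si≡h+u ⟨
      S * i  ∎)
      where
      double : ∀ h → 2 * h ≡ h + h
      double = solve-∀
    ... | no h≰u = inj₂ (below-root⇐key (begin
      S * (i * i)  ≡⟨ *-assoc S i i ⟨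
      S * i * i    ≡⟨ cong (_* i) Si≡h+u ⟩
      (h + u) * i  ≤⟨ *-monoˡ-≤ i (+-monoʳ-≤ h (<⇒≤ (≰⇒> h≰u))) ⟩
      (h + h) * i  ≡⟨ regroup h i ⟩
      h * (2 * i)  ≤⟨ *-monoʳ-≤ h 2i≤Ru ⟩
      h * (R * u)  ≡⟨ regroup′ R h u ⟩
      R * h * u    ∎))
      where
      regroup : ∀ h i → (h + h) * i ≡ h * (2 * i)
      regroup = solve-∀
      regroup′ : ∀ R h u → h * (R * u) ≡ R * h * u
      regroup′ = solve-∀

    above-root⇐linear : 4 ≤ R * S → R * u < 2 * i → S * i < 2 * h
    above-root⇐linear 4≤RS Ru<2i with u <? h
    ... | yes u<h = begin-strict
      S * i  ≡⟨ Si≡h+u ⟩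
      h + u  <⟨ +-monoʳ-< h u<h ⟩
      h + h  ≡⟨ double h ⟨
      2 * h  ∎
      where
      double : ∀ h → 2 * h ≡ h + h
      double = solve-∀
    ... | no u≮h = contradiction (begin-strict
      R * S * u    ≡⟨ regroup R S u ⟩
      S * (R * u)  <⟨ *-monoʳ-< S {{S≢0}} Ru<2i ⟩
      S * (2 * i)  ≡⟨ regroup′ S i ⟩
      2 * (S * i)  ≡⟨ cong (2 *_) Si≡h+u ⟩
      2 * (h + u)  ≤⟨ *-monoʳ-≤ 2 (+-monoˡ-≤ u (≮⇒≥ u≮h)) ⟩
      2 * (u + u)  ≡⟨ regroup″ u ⟩
      4 * u        ≤⟨ *-monoˡ-≤ u 4≤RS ⟩
      R * S * u    ∎) (<-irrefl refl)
      where
      S≢0 : NonZero S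
      S≢0 = m*n≢0⇒n≢0 R {{>-nonZero (≤-trans (s≤s z≤n) 4≤RS)}}
      regroup : ∀ R S u → R * S * u ≡ S * (R * u)
      regroup = solve-∀
      regroup′ : ∀ S i → S * (2 * i) ≡ 2 * (S * i)
      regroup′ = solve-∀
      regroup″ : ∀ u → 2 * (u + u) ≡ 4 * u
      regroup″ = solve-∀

  -- ⌊iβ⌋ = S i − ⌈i/γ⌉: the hypotheses say nγ < i ≤ (n + 1)γ for γ the root belonging to (S, R).
  floor-complement : ∀ {R S i n h} → 4 ≤ R * S → h + suc n ≡ S * i →
    LtIRoot S R n i → LeIRoot S R (suc n) i → LeIRoot R S i h × LtIRoot R S i (suc h)
  floor-complement {R} {S} {i} {n} {h} 4≤RS h+1+n≡Si (Rn<2i , dual-above) dual-below =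
    below dual-below ,
    Above.above-root⇐linear 4≤RS Rn<2i ,
    Above.above-root⇐key (Above.key⇐dual-above-root dual-above)
    where
    module Below = Reduction R S i h (suc n) (sym h+1+n≡Si)
    module Above = Reduction R S i (suc h) n (trans (sym h+1+n≡Si) (+-suc h n))
    below : LeIRoot S R (suc n) i → LeIRoot R S i h
    below (inj₁ linear) = Below.below-root⇐linear linear
    below (inj₂ dual) = inj₂ (Below.below-root⇐key (Below.key⇐dual-below-root dual))

  -- The case R = 1, S = 2 + c, with δ = β − 1 in the role of γ: now δ + 1/δ = c, the key
  -- inequality is i² + u² ≤ c u i, and the dual conditions are stated for β at i + u.
  module SelfReduction (c i h u : ℕ) (h+u≡[1+c]i : h + u ≡ suc c * i) where

    open ≤-Reasoning

    private
      offset = h * i + u * i + h * h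

      square-identity : (i * i + u * u) + offset ≡ (2 + c) * (i * i) + 1 * (h * h) + u * u
      square-identity = begin-equality
        (i * i + u * u) + offset                   ≡⟨ gather i h u ⟩
        (h + u) * i + i * i + h * h + u * u       ≡⟨ cong (λ t → t * i + i * i + h * h + u * u) h+u≡[1+c]i ⟩
        suc c * i * i + i * i + h * h + u * u     ≡⟨ expand c i h u ⟩
        (2 + c) * (i * i) + 1 * (h * h) + u * u   ∎
        where
        gather : ∀ i h u → (i * i + u * u) + (h * i + u * i + h * h) ≡ (h + u) * i + i * i + h * h + u * u
        gather = solve-∀
        expand : ∀ c i h u → suc c * i * i + i * i + h * h + u * u ≡ (2 + c) * (i * i) + 1 * (h * h) + u * u
        expand = solve-∀

      product-identity : c * u * i + offset ≡ 1 * (2 + c) * i * h + u * u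
      product-identity = begin-equality
        c * u * i + offset                ≡⟨ gather c i h u ⟩
        u * (suc c * i) + h * i + h * h   ≡⟨ cong (λ t → u * t + h * i + h * h) h+u≡[1+c]i ⟨
        u * (h + u) + h * i + h * h       ≡⟨ swap i h u ⟩
        (h + u) * h + i * h + u * u       ≡⟨ cong (λ t → t * h + i * h + u * u) h+u≡[1+c]i ⟩
        suc c * i * h + i * h + u * u     ≡⟨ expand c i h u ⟩
        1 * (2 + c) * i * h + u * u       ∎
        where
        gather : ∀ c i h u → c * u * i + (h * i + u * i + h * h) ≡ u * (suc c * i) + h * i + h * h
        gather = solve-∀
        swap : ∀ i h u → u * (h + u) + h * i + h * h ≡ (h + u) * h + i * h + u * u
        swap = solve-∀
        expand : ∀ c i h u → suc c * i * h + i * h + u * u ≡ 1 * (2 + c) * i * h + u * u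
        expand = solve-∀

    below-root⇐key : i * i + u * u ≤ c * u * i → (2 + c) * (i * i) + 1 * (h * h) ≤ 1 * (2 + c) * i * h
    below-root⇐key = ≤-reshape square-identity product-identity

    above-root⇐key : c * u * i < i * i + u * u → 1 * (2 + c) * i * h < (2 + c) * (i * i) + 1 * (h * h)
    above-root⇐key = <-reshape product-identity square-identity

    below-root⇐linear : 2 * (i + u) ≤ (2 + c) * u → LeIRoot 1 (2 + c) i h
    below-root⇐linear 2[i+u]≤[2+c]u with c * i ≤? 2 * u
    ... | yes ci≤2u = inj₁ (+-cancelʳ-≤ (2 * u) _ _ (begin
      2 * h + 2 * u               ≡⟨ *-distribˡ-+ 2 h u ⟨
      2 * (h + u)                 ≡⟨ cong (2 *_) h+u≡[1+c]i ⟩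
      2 * (suc c * i)             ≡⟨ split c i ⟩
      c * i + (2 + c) * i         ≤⟨ +-monoˡ-≤ ((2 + c) * i) ci≤2u ⟩
      2 * u + (2 + c) * i         ≡⟨ +-comm (2 * u) ((2 + c) * i) ⟩
      (2 + c) * i + 2 * u         ∎))
      where
      split : ∀ c i → 2 * (suc c * i) ≡ c * i + (2 + c) * i
      split = solve-∀
    ... | no ci≰2u = inj₂ (below-root⇐key (*-cancelˡ-≤ 2 (begin
      2 * (i * i + u * u)         ≡⟨ *-distribˡ-+ 2 (i * i) (u * u) ⟩
      2 * (i * i) + 2 * (u * u)   ≡⟨ cong₂ _+_ (*-assoc 2 i i) (*-assoc 2 u u) ⟨
      2 * i * i + 2 * u * u       ≤⟨ +-mono-≤ (*-monoˡ-≤ i 2i≤cu) (*-monoˡ-≤ u (<⇒≤ (≰⇒> ci≰2u))) ⟩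
      c * u * i + c * i * u       ≡⟨ double c i u ⟩
      2 * (c * u * i)             ∎)))
      where
      double : ∀ c i u → c * u * i + c * i * u ≡ 2 * (c * u * i)
      double = solve-∀
      2i≤cu : 2 * i ≤ c * u
      2i≤cu = +-cancelʳ-≤ (2 * u) _ _ (subst₂ _≤_ (*-distribˡ-+ 2 i u) (split c u) 2[i+u]≤[2+c]u)
        where
        split : ∀ c u → (2 + c) * u ≡ c * u + 2 * u
        split = solve-∀

    above-root⇐linear : 2 ≤ c → (2 + c) * u < 2 * (i + u) → (2 + c) * i < 2 * h
    above-root⇐linear 2≤c [2+c]u<2[i+u] = +-cancelʳ-< (2 * u) _ _ (begin-strict
      (2 + c) * i + 2 * u         <⟨ +-monoʳ-< ((2 + c) * i) 2u<ci ⟩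
      (2 + c) * i + c * i         ≡⟨ double c i ⟩
      2 * (suc c * i)             ≡⟨ cong (2 *_) h+u≡[1+c]i ⟨
      2 * (h + u)                 ≡⟨ *-distribˡ-+ 2 h u ⟩
      2 * h + 2 * u               ∎)
      where
      double : ∀ c i → (2 + c) * i + c * i ≡ 2 * (suc c * i)
      double = solve-∀
      split : ∀ c u → (2 + c) * u ≡ c * u + 2 * u
      split = solve-∀
      cu<2i : c * u < 2 * i
      cu<2i = +-cancelʳ-< (2 * u) _ _ (subst₂ _<_ (split c u) (*-distribˡ-+ 2 i u) [2+c]u<2[i+u])
      2u<ci : 2 * u < c * i
      2u<ci = begin-strict
        2 * u   ≤⟨ *-monoˡ-≤ u 2≤c ⟩
        c * u   <⟨ cu<2i ⟩
        2 * i   ≤⟨ *-monoˡ-≤ i 2≤c ⟩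
        c * i   ∎

  private
    self-dual-square : ∀ c i v →
      (2 + c) * (v * v) + 1 * ((i + v) * (i + v)) ≡ i * i + v * v + (2 * i * v + (2 + c) * (v * v))
    self-dual-square = solve-∀

    self-dual-product : ∀ c i v → 1 * (2 + c) * v * (i + v) ≡ c * v * i + (2 * i * v + (2 + c) * (v * v))
    self-dual-product = solve-∀

  key⇐dual-below-root : ∀ c i v → (2 + c) * (v * v) + 1 * ((i + v) * (i + v)) ≤ 1 * (2 + c) * v * (i + v) →
    i * i + v * v ≤ c * v * i
  key⇐dual-below-root c i v dual =
    +-cancelʳ-≤ _ _ _ (subst₂ _≤_ (self-dual-square c i v) (self-dual-product c i v) dual)

  key⇐dual-above-root : ∀ c i v → 1 * (2 + c) * v * (i + v) < (2 + c) * (v * v) + 1 * ((i + v) * (i + v)) →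
    c * v * i < i * i + v * v
  key⇐dual-above-root c i v dual =
    +-cancelʳ-< _ _ _ (subst₂ _<_ (self-dual-product c i v) (self-dual-square c i v) dual)

  floor-self-complement : ∀ {c i n h} → 2 ≤ c → h + suc n ≡ suc c * i →
    LtIRoot 1 (2 + c) n (i + n) → LeIRoot 1 (2 + c) (suc n) (i + suc n) →
    LeIRoot 1 (2 + c) i h × LtIRoot 1 (2 + c) i (suc h)
  floor-self-complement {c} {i} {n} {h} 2≤c h+1+n≡[1+c]i (linear , dual-above) dual-below =
    below dual-below ,
    Above.above-root⇐linear 2≤c linear ,
    Above.above-root⇐key (key⇐dual-above-root c i n dual-above)
    where
    module Below = SelfReduction c i h (suc n) h+1+n≡[1+c]i
    module Above = SelfReduction c i (suc h) n (trans (sym (+-suc h n)) h+1+n≡[1+c]i)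
    below : LeIRoot 1 (2 + c) (suc n) (i + suc n) → LeIRoot 1 (2 + c) i h
    below (inj₁ linear) = Below.below-root⇐linear linear
    below (inj₂ dual) = inj₂ (Below.below-root⇐key (key⇐dual-below-root c i (suc n) dual))

module Substitutions where

  open import Data.Nat
  open import Data.Nat.Properties using (≤-refl)
  open import Data.Product using (_×_; _,_; map)
  open import Data.List using (List; []; _∷_; _++_; concatMap)
  open import Data.List.Properties using (++-identityʳ; concatMap-++)
  open import Data.List.Relation.Unary.All using (All; []; _∷_)
  open import Data.List.Relation.Unary.All.Properties using (++⁺; concat⁺; replicate⁺)
  open import Function using (_∘_)
  open import Relation.Binary.PropositionalEquality
  open import Defs

  Words : Set
  Words = List ℕ × List ℕ

  simple-step : ℕ → ℕ → Words → Words
  simple-step a b (U , W) = (W ++ rep U a , W ++ rep U b)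

  layered-step : ℕ → ℕ → ℕ → ℕ → Words → Words
  layered-step a a′ b b′ (U , W) =
    ( W ++ rep U a ++ rep (W ++ rep U a′) b
    , W ++ rep U a ++ rep (W ++ rep U a′) b′ )

  orbit-image : ∀ {A : Set} (step φ : A → A) {u v : ℕ → A} →
    (∀ x → step (φ x) ≡ φ (step x)) →
    (∀ k → u (suc k) ≡ step (u k)) → (∀ k → v (suc k) ≡ step (v k)) →
    v 0 ≡ φ (u 0) → ∀ k → v k ≡ φ (u k)
  orbit-image step φ {u} {v} commute u-step v-step base zero = base
  orbit-image step φ {u} {v} commute u-step v-step base (suc k) = begin
    v (suc k)      ≡⟨ v-step k ⟩
    step (v k)     ≡⟨ cong step (orbit-image step φ commute u-step v-step base k) ⟩
    step (φ (u k)) ≡⟨ commute (u k) ⟩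
    φ (step (u k)) ≡⟨ cong φ (u-step k) ⟨
    φ (u (suc k))  ∎
    where open ≡-Reasoning

  module _ (g : ℕ → List ℕ) where

    concatMap-rep : ∀ x a → concatMap g (rep x a) ≡ rep (concatMap g x) a
    concatMap-rep x zero = refl
    concatMap-rep x (suc a) = trans (concatMap-++ g x (rep x a)) (cong (concatMap g x ++_) (concatMap-rep x a))

    concatMap-++-rep : ∀ W U a → concatMap g (W ++ rep U a) ≡ concatMap g W ++ rep (concatMap g U) a
    concatMap-++-rep W U a = trans (concatMap-++ g W (rep U a)) (cong (concatMap g W ++_) (concatMap-rep U a))

    simple-step-concatMap : ∀ a b UW →
      simple-step a b (map (concatMap g) (concatMap g) UW) ≡ map (concatMap g) (concatMap g) (simple-step a b UW)
    simple-step-concatMap a b (U , W) = sym (cong₂ _,_ (concatMap-++-rep W U a) (concatMap-++-rep W U b))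

    layered-step-concatMap : ∀ a a′ b b′ UW →
      layered-step a a′ b b′ (map (concatMap g) (concatMap g) UW) ≡ map (concatMap g) (concatMap g) (layered-step a a′ b b′ UW)
    layered-step-concatMap a a′ b b′ (U , W) = sym (cong₂ _,_ (layer b) (layer b′))
      where
      open ≡-Reasoning
      φ = concatMap g
      layer : ∀ c → φ (W ++ rep U a ++ rep (W ++ rep U a′) c) ≡ φ W ++ rep (φ U) a ++ rep (φ W ++ rep (φ U) a′) c
      layer c = begin
        φ (W ++ rep U a ++ rep (W ++ rep U a′) c)              ≡⟨ concatMap-++ g W _ ⟩
        φ W ++ φ (rep U a ++ rep (W ++ rep U a′) c)            ≡⟨ cong (φ W ++_) (concatMap-++ g (rep U a) _) ⟩
        φ W ++ φ (rep U a) ++ φ (rep (W ++ rep U a′) c)        ≡⟨ cong₂ (λ x y → φ W ++ x ++ y) (concatMap-rep U a) (concatMap-rep _ c) ⟩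
        φ W ++ rep (φ U) a ++ rep (φ (W ++ rep U a′)) c        ≡⟨ cong (λ x → φ W ++ rep (φ U) a ++ rep x c) (concatMap-++-rep W U a′) ⟩
        φ W ++ rep (φ U) a ++ rep (φ W ++ rep (φ U) a′) c      ∎

  block : ℕ → ℕ → ℕ → ℕ → List ℕ
  block f r d x = f ∷ rep (r ∷ []) (d ∸ x)

  block-letters : ∀ {f r} d → r ≤ f → ∀ X → All (_≤ f) (concatMap (block f r d) X)
  block-letters d r≤f [] = []
  block-letters d r≤f (x ∷ xs) = ≤-refl ∷ ++⁺ (concat⁺ (replicate⁺ (d ∸ x) (r≤f ∷ []))) (block-letters d r≤f xs)

  concatMap-singleton : ∀ (g : ℕ → List ℕ) x → concatMap g (x ∷ []) ≡ g x
  concatMap-singleton g x = ++-identityʳ (g x)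

  module _ (a b : ℕ) where
    private
      σp σq : ℕ → List ℕ
      σp = block 3 2 (3 + a)
      σq = block 3 2 (3 + b)
      Ψ : List ℕ → List ℕ
      Ψ = concatMap σp ∘ concatMap σq

    words-general : ∀ k → words (4 + a) (4 + b) (suc k) ≡ map Ψ Ψ (words (4 + a) (4 + b) k)
    words-general = orbit-image (layered-step a (suc a) (suc b) b) (map Ψ Ψ)
      {words (4 + a) (4 + b)} {words (4 + a) (4 + b) ∘ suc} commute (λ _ → refl) (λ _ → refl)
      (cong₂ _,_ (sym (Ψ-singleton 2)) (sym (Ψ-singleton 3)))
      where
      commute : ∀ UW → layered-step a (suc a) (suc b) b (map Ψ Ψ UW) ≡ map Ψ Ψ (layered-step a (suc a) (suc b) b UW)
      commute UW = trans (layered-step-concatMap σp a (suc a) (suc b) b (map (concatMap σq) (concatMap σq) UW))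
                         (cong (map (concatMap σp) (concatMap σp)) (layered-step-concatMap σq a (suc a) (suc b) b UW))
      Ψ-singleton : ∀ x → Ψ (x ∷ []) ≡ σp 3 ++ rep (σp 2) ((3 + b) ∸ x)
      Ψ-singleton x = begin
        concatMap σp (concatMap σq (x ∷ []))          ≡⟨ cong (concatMap σp) (concatMap-singleton σq x) ⟩
        σp 3 ++ concatMap σp (rep (2 ∷ []) (3 + b ∸ x)) ≡⟨ cong (σp 3 ++_) (concatMap-rep σp (2 ∷ []) (3 + b ∸ x)) ⟩
        σp 3 ++ rep (concatMap σp (2 ∷ [])) (3 + b ∸ x) ≡⟨ cong (λ w → σp 3 ++ rep w (3 + b ∸ x)) (concatMap-singleton σp 2) ⟩
        σp 3 ++ rep (σp 2) (3 + b ∸ x)                ∎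
        where open ≡-Reasoning

  words-self : ∀ b k → let ψ* = concatMap (block 4 3 (5 + b)) in
    words 3 (7 + b) (suc k) ≡ map ψ* ψ* (words 3 (7 + b) k)
  words-self b = orbit-image (simple-step (2 + b) (1 + b)) (map ψ* ψ*) {words 3 (7 + b)} {words 3 (7 + b) ∘ suc}
    (simple-step-concatMap (block 4 3 (5 + b)) (2 + b) (1 + b))
    (λ _ → refl) (λ _ → refl) (cong₂ _,_ (sym (++-identityʳ _)) (sym (++-identityʳ _)))
    where
    ψ* = concatMap (block 4 3 (5 + b))

  words-co-self : ∀ a k → let σ* = concatMap (block 3 2 (6 + a)) in
    words (7 + a) 3 (suc k) ≡ map σ* σ* (words 3 (7 + a) k)
  words-co-self a = orbit-image (simple-step (2 + a) (1 + a)) (map σ* σ*) {words 3 (7 + a)} {words (7 + a) 3 ∘ suc}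
    (simple-step-concatMap (block 3 2 (6 + a)) (2 + a) (1 + a))
    (λ _ → refl) (λ _ → refl) (cong₂ _,_ (sym (++-identityʳ _)) (sym (++-identityʳ _)))
    where
    σ* = concatMap (block 3 2 (6 + a))

module FloorWords where

  open import Data.Nat
  open import Data.Nat.Properties
  open import Data.Nat.Tactic.RingSolver using (solve-∀)
  open import Data.Product using (_×_; _,_; ∃₂)
  open import Data.Unit using (⊤; tt)
  open import Data.List using (List; []; _∷_; _++_; concatMap; length; lookup)
  open import Data.List.Relation.Unary.All using (All; []; _∷_)
  open import Data.Fin using (Fin; toℕ)
  import Data.Fin as Fin
  import Data.Integer as ℤ
  import Data.Integer.Properties as ℤ
  import Data.Integer.Tactic.RingSolver as ℤ
  open import Relation.Binary.PropositionalEquality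
  open import Defs
  open Substitutions

  -- F i h reads h = ⌊iα⌋. Placed at index i with floor h, the word W is the word of α when each
  -- letter x advances the index by one and the floor by c − x.
  IsFloorWord : (ℕ → ℕ → Set) → ℕ → ℕ → ℕ → List ℕ → Set
  IsFloorWord F c i h [] = ⊤
  IsFloorWord F c i h (x ∷ xs) = F (suc i) (h + (c ∸ x)) × IsFloorWord F c (suc i) (h + (c ∸ x)) xs

  IsFloorWord-++⁻ˡ : ∀ {F c} xs {ys i h} → IsFloorWord F c i h (xs ++ ys) → IsFloorWord F c i h xs
  IsFloorWord-++⁻ˡ []       _             = tt
  IsFloorWord-++⁻ˡ (x ∷ xs) (floor , rest) = floor , IsFloorWord-++⁻ˡ xs rest

  IsFloorWord-shift : ∀ {F d} X {i h} → All (_≤ d) X → IsFloorWord F (suc d) i (h + i) X →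
    IsFloorWord (λ j g → F j (g + j)) d i h X
  IsFloorWord-shift [] _ _ = tt
  IsFloorWord-shift {F} {d} (x ∷ xs) {i} {h} (x≤d ∷ xs≤d) (floor , rest) =
    subst (F (suc i)) shifted floor ,
    IsFloorWord-shift xs xs≤d (subst (λ g → IsFloorWord F (suc d) (suc i) g xs) shifted rest)
    where
    shifted : h + i + (suc d ∸ x) ≡ h + (d ∸ x) + suc i
    shifted = trans (cong (h + i +_) (+-∸-assoc 1 x≤d)) (regroup h i (d ∸ x))
      where
      regroup : ∀ h i e → h + i + suc e ≡ h + e + suc i
      regroup = solve-∀

  letter-from-floors : ∀ {c x} h → x ≤ c → ℤ.+ x ≡ (ℤ.+ c ℤ.- ℤ.+ (h + (c ∸ x))) ℤ.+ ℤ.+ h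
  letter-from-floors {c} {x} h x≤c = begin
    ℤ.+ x
      ≡⟨ identity (ℤ.+ x) (ℤ.+ (c ∸ x)) (ℤ.+ h) ⟩
    (ℤ.+ x ℤ.+ ℤ.+ (c ∸ x) ℤ.- (ℤ.+ h ℤ.+ ℤ.+ (c ∸ x))) ℤ.+ ℤ.+ h
      ≡⟨ cong₂ (λ a b → (a ℤ.- b) ℤ.+ ℤ.+ h) (ℤ.pos-+ x (c ∸ x)) (ℤ.pos-+ h (c ∸ x)) ⟨
    (ℤ.+ (x + (c ∸ x)) ℤ.- ℤ.+ (h + (c ∸ x))) ℤ.+ ℤ.+ h
      ≡⟨ cong (λ a → (ℤ.+ a ℤ.- ℤ.+ (h + (c ∸ x))) ℤ.+ ℤ.+ h) (m+[n∸m]≡n x≤c) ⟩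
    (ℤ.+ c ℤ.- ℤ.+ (h + (c ∸ x))) ℤ.+ ℤ.+ h ∎
    where
    open ≡-Reasoning
    identity : ∀ x d h → x ≡ (x ℤ.+ d ℤ.- (h ℤ.+ d)) ℤ.+ h
    identity = ℤ.solve-∀

  IsFloorWord-lookup : ∀ {F c} W {i h} → IsFloorWord F c i h W → F i h → All (_≤ c) W →
    (j : Fin (length W)) →
    ∃₂ λ n n′ → F (i + suc (toℕ j)) n × F (i + toℕ j) n′ × (ℤ.+ lookup W j ≡ (ℤ.+ c ℤ.- ℤ.+ n) ℤ.+ ℤ.+ n′)
  IsFloorWord-lookup {F} {c} (x ∷ _) {i} {h} (floor , _) floor₀ (x≤c ∷ _) Fin.zero =
    h + (c ∸ x) , h ,
    subst (λ k → F k (h + (c ∸ x))) (+-comm 1 i) floor ,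
    subst (λ k → F k h) (sym (+-identityʳ i)) floor₀ ,
    letter-from-floors h x≤c
  IsFloorWord-lookup {F} (_ ∷ xs) {i} (floor , rest) _ (_ ∷ xs≤c) (Fin.suc j)
    with IsFloorWord-lookup xs rest floor xs≤c j
  ... | n , n′ , next , this , letter =
    n , n′ ,
    subst (λ k → F k n) (sym (+-suc i (suc (toℕ j)))) next ,
    subst (λ k → F k n′) (sym (+-suc i (toℕ j))) this ,
    letter

  -- From the word of θ to the word of α = (t + 1) − 1/θ. Ge m i and Gt n i stand for i ≤ mθ and
  -- nθ < i, and floor-step is ⌊iα⌋ = (t + 1) i − ⌈i/θ⌉. A letter x of the θ-word at n covers the
  -- α-indices up to ⌊(n + 1)θ⌋, on all of which ⌈i/θ⌉ = n + 1; so the α-floor grows by t at the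
  -- first of them and by t + 1 at the others, which is the block f r^(d−x) when the θ-word is
  -- read with constant d + 1.
  module Transfer
    (F Ge Gt : ℕ → ℕ → Set) (c t f r d : ℕ) (c∸f≡t : c ∸ f ≡ t) (c∸r≡1+t : c ∸ r ≡ suc t)
    (Gt-mono : ∀ {n i j} → i ≤ j → Gt n i → Gt n j)
    (Ge-antimono : ∀ {m i j} → i ≤ j → Ge m j → Ge m i)
    (floor-step : ∀ {i n h} → h + suc n ≡ suc t * i → Gt n i → Ge (suc n) i → F i h)
    where

    FloorΘ : ℕ → ℕ → Set
    FloorΘ n a = Ge n a × Gt n (suc a)

    private
      next-floor : ∀ {h n i} → h + n ≡ suc t * i → h + n + suc t ≡ suc t * suc i
      next-floor {i = i} invariant =
        trans (cong (_+ suc t) invariant) (trans (+-comm (suc t * i) (suc t)) (sym (*-suc (suc t) i)))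

    run : ∀ m {n i j h} rest → m + i ≡ j → h + suc n ≡ suc t * i → Gt n i → Ge (suc n) j →
      (∀ {h′} → h′ + suc n ≡ suc t * j → IsFloorWord F c j h′ rest) →
      IsFloorWord F c i h (rep (r ∷ []) m ++ rest)
    run zero rest refl invariant _ _ continue = continue invariant
    run (suc m) {n} {i} {j} {h} rest 1+m+i≡j invariant gt ge continue =
      floor-step invariant′ gt′ (Ge-antimono (≤-trans (s≤s (m≤n+m i m)) (≤-reflexive 1+m+i≡j)) ge) ,
      run m rest (trans (+-suc m i) 1+m+i≡j) invariant′ gt′ ge continue
      where
      gt′ : Gt n (suc i)
      gt′ = Gt-mono (n≤1+n i) gt
      invariant′ : h + (c ∸ r) + suc n ≡ suc t * suc i
      invariant′ = begin
        h + (c ∸ r) + suc n  ≡⟨ cong (λ e → h + e + suc n) c∸r≡1+t ⟩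
        h + suc t + suc n    ≡⟨ regroup h t n ⟩
        h + suc n + suc t    ≡⟨ next-floor {h} invariant ⟩
        suc t * suc i        ∎
        where
        open ≡-Reasoning
        regroup : ∀ h t n → h + suc t + suc n ≡ h + suc n + suc t
        regroup = solve-∀

    transfer : ∀ X {n a h} → All (_≤ d) X → h + n ≡ suc t * a → Gt n (suc a) →
      IsFloorWord FloorΘ (suc d) n a X → IsFloorWord F c a h (concatMap (block f r d) X)
    transfer [] _ _ _ _ = tt
    transfer (x ∷ xs) {n} {a} {h} (x≤d ∷ xs≤d) invariant gt ((ge′ , gt′) , rest) =
      floor-step invariant′ gt (Ge-antimono (≤-trans (m≤n+m (suc a) (d ∸ x)) (≤-reflexive block-end)) ge′) ,
      run (d ∸ x) (concatMap (block f r d) xs) block-end invariant′ gt ge′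
        (λ invariant″ → transfer xs xs≤d invariant″ gt′ rest)
      where
      block-end : d ∸ x + suc a ≡ a + (suc d ∸ x)
      block-end = trans (regroup (d ∸ x) a) (cong (a +_) (sym (+-∸-assoc 1 x≤d)))
        where
        regroup : ∀ e a → e + suc a ≡ a + suc e
        regroup = solve-∀
      invariant′ : h + (c ∸ f) + suc n ≡ suc t * suc a
      invariant′ = begin
        h + (c ∸ f) + suc n  ≡⟨ cong (λ e → h + e + suc n) c∸f≡t ⟩
        h + t + suc n        ≡⟨ regroup h t n ⟩
        h + n + suc t        ≡⟨ next-floor {h} invariant ⟩
        suc t * suc a        ∎
        where
        open ≡-Reasoning
        regroup : ∀ h t n → h + t + suc n ≡ h + n + suc t
        regroup = solve-∀

module Cases where

  open import Data.Nat
  open import Data.Nat.Properties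
  open import Data.Product using (_×_; _,_; proj₁; proj₂; map; map₂)
  open import Data.Sum using (inj₁)
  open import Data.Unit using (tt)
  open import Data.List using (List; []; _∷_; concatMap)
  open import Data.List.Relation.Unary.All as All using (All; []; _∷_)
  open import Data.List.Relation.Unary.All.Properties using (++⁻ˡ)
  open import Relation.Binary.PropositionalEquality
  open import Defs
  open Roots
  open Complements
  open Substitutions
  open FloorWords

  FloorWord : ℕ → ℕ → ℕ → List ℕ → Set
  FloorWord p q e W = IsFloorWord (IsFloorIBeta p q) q 0 0 W × All (_≤ e) W

  private
    4≤5+n : ∀ {n} → 4 ≤ 5 + n
    4≤5+n = s≤s (s≤s (s≤s (s≤s z≤n)))

    letters-≤ : ∀ {e e′ W} → e ≤ e′ → All (_≤ e) W → All (_≤ e′) W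
    letters-≤ e≤e′ = All.map (λ x≤e → ≤-trans x≤e e≤e′)

  module DualTransfer (R′ S′ : ℕ) (4≤RS : 4 ≤ suc R′ * suc S′) where

    private
      4≤SR : 4 ≤ suc S′ * suc R′
      4≤SR = subst (4 ≤_) (*-comm (suc R′) (suc S′)) 4≤RS
      module Source = RootConversion (suc S′) (suc R′) 4≤SR
      module Target = RootConversion (suc R′) (suc S′) 4≤RS

    floor-step : ∀ {i n h} → h + suc n ≡ suc S′ * i →
      LtIBeta (3 + S′) (3 + R′) n i → LeIBeta (3 + S′) (3 + R′) (suc n) i → IsFloorIBeta (3 + R′) (3 + S′) i h
    floor-step {i} {n} {h} invariant above below =
      map (Target.LeIRoot⇒LeIBeta {i} {h}) (Target.LtIRoot⇒LtIBeta {i} {suc h})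
        (floor-complement {suc R′} {suc S′} {i} {n} {h} 4≤RS invariant
          (Source.LtIBeta⇒LtIRoot {n} {i} above) (Source.LeIBeta⇒LeIRoot {suc n} {i} below))

    open Transfer (IsFloorIBeta (3 + R′) (3 + S′)) (LeIBeta (3 + S′) (3 + R′)) (LtIBeta (3 + S′) (3 + R′))
      (3 + S′) S′ 3 2 (2 + R′) refl refl (λ {n} → LtIBeta-mono {3 + S′} {3 + R′} {n}) (λ {m} → LeIBeta-antimono {3 + S′} {3 + R′} {m})
      floor-step public

  -- θ = β − 1 is encoded through β: i ≤ mθ is i + m ≤ mβ.
  module SelfTransfer (b : ℕ) where

    open RootConversion 1 (5 + b) 4≤5+n

    floor-step : ∀ {i n h} → h + suc n ≡ (4 + b) * i →
      LtIBeta 3 (7 + b) n (i + n) → LeIBeta 3 (7 + b) (suc n) (i + suc n) → IsFloorIBeta 3 (7 + b) i h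
    floor-step {i} {n} {h} invariant above below =
      map (LeIRoot⇒LeIBeta {i} {h}) (LtIRoot⇒LtIBeta {i} {suc h})
        (floor-self-complement {3 + b} {i} {n} {h} (s≤s (s≤s z≤n)) invariant
          (LtIBeta⇒LtIRoot {n} {i + n} above) (LeIBeta⇒LeIRoot {suc n} {i + suc n} below))

    open Transfer (IsFloorIBeta 3 (7 + b)) (λ m i → LeIBeta 3 (7 + b) m (i + m)) (λ n i → LtIBeta 3 (7 + b) n (i + n))
      (7 + b) (3 + b) 4 3 (5 + b) refl refl (λ {n} i≤j → LtIBeta-mono {3} {7 + b} {n} (+-monoˡ-≤ n i≤j))
      (λ {m} i≤j → LeIBeta-antimono {3} {7 + b} {m} (+-monoˡ-≤ m i≤j))
      (λ {i} {n} {h} → floor-step {i} {n} {h}) public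

  module CaseGeneral (a b : ℕ) (4≤RS : 4 ≤ (2 + a) * (2 + b)) where

    private
      4≤SR : 4 ≤ (2 + b) * (2 + a)
      4≤SR = subst (4 ≤_) (*-comm (2 + a) (2 + b)) 4≤RS
      module Forward = DualTransfer (suc a) (suc b) 4≤RS
      module Backward = DualTransfer (suc b) (suc a) 4≤SR

    floor-word-step : ∀ {X} → FloorWord (4 + a) (4 + b) 3 X →
      FloorWord (4 + a) (4 + b) 3 (concatMap (block 3 2 (3 + a)) (concatMap (block 3 2 (3 + b)) X))
    floor-word-step {X} (word , letters) = word″ , block-letters (3 + a) (n≤1+n 2) Y
      where
      Y = concatMap (block 3 2 (3 + b)) X
      word′ : IsFloorWord (IsFloorIBeta (4 + b) (4 + a)) (4 + a) 0 0 Y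
      word′ = Backward.transfer X (letters-≤ (m≤m+n 3 b) letters) (sym (*-zeroʳ (2 + a)))
        (proj₂ (floor-zero (2 + a) (2 + b) 4≤RS)) word
      word″ = Forward.transfer Y (letters-≤ (m≤m+n 3 a) (block-letters (3 + b) (n≤1+n 2) X)) (sym (*-zeroʳ (2 + b)))
        (proj₂ (floor-zero (2 + b) (2 + a) 4≤SR)) word′

    floor-word : ∀ k → FloorWord (4 + a) (4 + b) 3 (Wword (4 + a) (4 + b) k)
    floor-word zero = (first , tt) , ≤-refl ∷ []
      where
      first : IsFloorIBeta (4 + a) (4 + b) 1 (1 + b)
      first = Forward.floor-step {1} {0} {1 + b} (trans (+-comm (1 + b) 1) (sym (*-identityʳ (2 + b))))
        (proj₂ (floor-zero (2 + b) (2 + a) 4≤SR))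
        (RootConversion.LeIRoot⇒LeIBeta (2 + b) (2 + a) 4≤SR {1} {1}
          (inj₁ (s≤s (s≤s z≤n))))
    floor-word (suc k) = subst (FloorWord (4 + a) (4 + b) 3) (sym (cong proj₂ (words-general a b k)))
      (floor-word-step (floor-word k))

  module CaseP≡3 (b : ℕ) where

    private
      module Self′ = SelfTransfer b

    floor-word-step : ∀ {X} → FloorWord 3 (7 + b) 4 X → FloorWord 3 (7 + b) 4 (concatMap (block 4 3 (5 + b)) X)
    floor-word-step {X} (word , letters) =
      Self′.transfer X (letters-≤ (m≤m+n 4 (suc b)) letters) (sym (*-zeroʳ (4 + b)))
        (proj₂ (floor-zero 1 (5 + b) 4≤5+n))
        (IsFloorWord-shift X (letters-≤ (m≤m+n 4 (2 + b)) letters) word) ,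
      block-letters (5 + b) (n≤1+n 3) X

    floor-word : ∀ k → FloorWord 3 (7 + b) 4 (Wword 3 (7 + b) k)
    floor-word zero = (first , tt) , ≤-refl ∷ []
      where
      first : IsFloorIBeta 3 (7 + b) 1 (3 + b)
      first = Self′.floor-step {1} {0} {3 + b} (trans (+-comm (3 + b) 1) (sym (*-identityʳ (4 + b))))
        (proj₂ (floor-zero 1 (5 + b) 4≤5+n))
        (RootConversion.LeIRoot⇒LeIBeta 1 (5 + b) 4≤5+n {1} {2}
          (inj₁ 4≤5+n))
    floor-word (suc k) = subst (FloorWord 3 (7 + b) 4) (sym (cong proj₂ (words-self b k)))
      (floor-word-step (floor-word k))

  module CaseQ≡3 (a : ℕ) where

    private
      module Forward = DualTransfer (4 + a) 0 4≤5+n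

    floor-word-step : ∀ {X} → FloorWord 3 (7 + a) 4 X → FloorWord (7 + a) 3 3 (concatMap (block 3 2 (6 + a)) X)
    floor-word-step {X} (word , letters) =
      Forward.transfer X {0} {0} {0} (letters-≤ (m≤m+n 4 (2 + a)) letters) (sym (*-zeroʳ 1))
        (proj₂ (floor-zero 1 (5 + a) 4≤5+n)) word ,
      block-letters (6 + a) (n≤1+n 2) X

    floor-word : ∀ k → FloorWord (7 + a) 3 3 (Wword (7 + a) 3 k)
    -- W₁ = 32 is not a σ-image, but it is a prefix of W₂.
    floor-word zero =
      IsFloorWord-++⁻ˡ {IsFloorIBeta (7 + a) 3} {3} (3 ∷ 2 ∷ []) {rep (2 ∷ []) (1 + a)} {0} {0} (proj₁ (floor-word 1)) ,
      ++⁻ˡ (3 ∷ 2 ∷ []) (proj₂ (floor-word 1))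
    floor-word (suc k) = subst (FloorWord (7 + a) 3 3) (sym (cong proj₂ (words-co-self a k)))
      (floor-word-step (CaseP≡3.floor-word a k))

  data Shape : ℕ → ℕ → Set where
    p≡3 : ∀ b → Shape 3 (7 + b)
    q≡3 : ∀ a → Shape (7 + a) 3
    p,q≥4 : ∀ a b → 4 ≤ (2 + a) * (2 + b) → Shape (4 + a) (4 + b)

  shape : ∀ p q → 3 ≤ p → 3 ≤ q → 4 < (p ∸ 2) * (q ∸ 2) → Shape p q
  shape _ 1 _ (s≤s ()) _
  shape _ 2 _ (s≤s (s≤s ())) _
  shape 3 3 _ _ (s≤s ())
  shape 3 4 _ _ (s≤s (s≤s ()))
  shape 3 5 _ _ (s≤s (s≤s (s≤s ())))
  shape 3 6 _ _ (s≤s (s≤s (s≤s (s≤s ()))))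
  shape 3 (suc (suc (suc (suc (suc (suc (suc b))))))) _ _ _ = p≡3 b
  shape 4 3 _ _ (s≤s (s≤s ()))
  shape 5 3 _ _ (s≤s (s≤s (s≤s ())))
  shape 6 3 _ _ (s≤s (s≤s (s≤s (s≤s ()))))
  shape (suc (suc (suc (suc (suc (suc (suc a))))))) 3 _ _ _ = q≡3 a
  shape (suc (suc (suc (suc a)))) (suc (suc (suc (suc b)))) _ _ 4<RS = p,q≥4 a b (<⇒≤ 4<RS)

  floor-word : ∀ {p q} → Shape p q → ∀ k → IsFloorIBeta p q 0 0 × FloorWord p q q (Wword p q k)
  floor-word (p≡3 b) k =
    floor-zero 1 (5 + b) 4≤5+n ,
    map₂ (letters-≤ (m≤m+n 4 (3 + b))) (CaseP≡3.floor-word b k)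
  floor-word (q≡3 a) k =
    floor-zero (5 + a) 1 4≤5+n ,
    CaseQ≡3.floor-word a k
  floor-word (p,q≥4 a b 4≤RS) k =
    floor-zero (2 + a) (2 + b) 4≤RS ,
    map₂ (letters-≤ (m≤m+n 3 (suc b))) (CaseGeneral.floor-word a b 4≤RS k)

open Cases using (shape; floor-word)
open FloorWords using (IsFloorWord-lookup)

open import Defs
open import Data.Nat using (ℕ; suc; _∸_; _*_; _≤_; _<_)
open import Data.List using (length; lookup)
open import Data.Fin using (Fin; toℕ)
open import Data.Product using (∃₂; _×_; _,_)
open import Data.Integer using (+_; _+_; _-_)
open import Relation.Binary.PropositionalEquality using (_≡_)

theorem2p3 : (p q : ℕ) → 3 ≤ p → 3 ≤ q → 4 < (p ∸ 2) * (q ∸ 2) →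
    (k : ℕ) (j : Fin (length (Wword p q k))) →
    ∃₂ λ n n′ → IsFloorIBeta p q (suc (toℕ j)) n × IsFloorIBeta p q (toℕ j) n′ ×
      (+ lookup (Wword p q k) j ≡ (+ q - + n) + + n′)
theorem2p3 p q 3≤p 3≤q 4<RS k =
  let floor₀ , word , letters = floor-word (shape p q 3≤p 3≤q 4<RS) k
  in IsFloorWord-lookup (Wword p q k) word floor₀ letters
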